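{- If $u$ is a sequence with exactly two distinct letters and length $t$, then $\mathit{fw}(u)=t-1$.
   Context: A sequence $s$ contains a sequence $u$ if some subsequence of $s$ can be changed into $u$ by a one-to-one renaming of its letters. An $(r,s)$-formation is a concatenation of $s$ permutations of the same set of $r$ distinct letters. The formation width $\mathit{fw}(u)$ is the minimum $s$ such that there exists $r$ for which every $(r,s)$-formation contains $u$. -}

module Defs where

open import Data.Nat using (ℕ; _<_)
open import Data.List using (List; length; map; concat)
open import Data.List.Membership.Propositional using (_∈_)
open import Data.List.Relation.Unary.All using (All)
open import Data.List.Relation.Unary.Unique.Propositional using (Unique)
open import Data.List.Relation.Binary.Sublist.Propositional using (_⊆_)
open import Data.List.Relation.Binary.Permutation.Propositional using (_↭_)
open import Data.Product using (Σ; _×_; ∃; ∃-syntax)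
open import Data.Sum using (_⊎_)
open import Relation.Binary.PropositionalEquality using (_≡_; _≢_)
open import Relation.Nullary using (¬_)

Seq : Set
Seq = List ℕ

InjectiveOn : (ℕ → ℕ) → Seq → Set
InjectiveOn f w = ∀ {x y} → x ∈ w → y ∈ w → f x ≡ f y → x ≡ y

Contains : Seq → Seq → Set
Contains s u = ∃[ w ] ((w ⊆ s) × ∃[ f ] (InjectiveOn f w × map f w ≡ u))

IsFormation : ℕ → ℕ → Seq → Set
IsFormation r s x =
  ∃[ L ] ((length L ≡ r) × Unique L ×
    ∃[ ps ] ((length ps ≡ s) × All (_↭ L) ps × (x ≡ concat ps)))

FormationForces : Seq → ℕ → Set
FormationForces u s = ∃[ r ] (∀ x → IsFormation r s x → Contains x u)

FormationWidthIs : Seq → ℕ → Set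
FormationWidthIs u s = FormationForces u s × (∀ s' → s' < s → ¬ FormationForces u s')

ExactlyTwoLetters : Seq → Set
ExactlyTwoLetters u =
  ∃[ a ] ∃[ b ] ((a ≢ b) × (a ∈ u) × (b ∈ u) × (∀ {x} → x ∈ u → (x ≡ a ⊎ x ≡ b)))

-- Upper bound: a sequence u over two letters has two distinct adjacent letters x y. The blocks
-- of a (2, t − 1)-formation all read cd or dc, so renaming the letters of the formation so that
-- the block meant for x y reads x y, and sending every other letter of u into a block of its
-- own, embeds u.
-- Lower bound: for s < t − 1 let block i be 0 1 … r−1 or its reverse according to the letter
-- u_i (i = 1 … s) following u₀. An embedding of u uses only two letters p q of the formation,
-- and reversal swaps them, so after renaming either every block i reads ū_i u_i or every one
-- reads u_i ū_i. In the first case u_i cannot be matched before block i ends, in the second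
-- not before block i + 1 begins; either way u_{s+1}, resp. u_s, finds no room.
module Submission where

open import Defs
open import Data.Bool using (Bool; true; false; if_then_else_)
open import Data.Empty using (⊥; ⊥-elim)
open import Data.Nat using (ℕ; zero; suc; _+_; _∸_; _<_; _≟_)
open import Data.Nat.Properties using (suc-injective; +-suc; m≤n⇒∃[o]m+o≡n)
open import Data.List using (List; []; _∷_; _++_; [_]; map; concat; concatMap; filter; reverse; length; upTo)
open import Data.List.Properties
  using (map-++; concat-map; concat-++; filter-++; filter-all; reverse-map; unfold-reverse; ++-identityʳ;
         length-++; length-map; length-upTo)
open import Data.List.Membership.Propositional using (_∈_)
open import Data.List.Membership.Propositional.Properties using (∈-map⁺; ∈-map⁻; ∈-concat⁻′; ∈-filter⁺; ∈-filter⁻)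
open import Data.List.Relation.Unary.Any using (here; there)
open import Data.List.Relation.Unary.All as All using (All; []; _∷_)
import Data.List.Relation.Unary.All.Properties as Allₚ
open import Data.List.Relation.Unary.AllPairs using ([]; _∷_)
open import Data.List.Relation.Unary.Unique.Propositional using (Unique)
open import Data.List.Relation.Unary.Unique.Propositional.Properties as Uniqueₚ using (upTo⁺)
open import Data.List.Relation.Binary.Sublist.Propositional using (_⊆_; []; _∷_; _∷ʳ_; lookup; from∈)
open import Data.List.Relation.Binary.Sublist.Propositional.Properties using (∷ˡ⁻; ++⁺; map⁺; filter⁺)
open import Data.List.Relation.Binary.Permutation.Propositional using (_↭_; ↭-refl; ↭-sym; ↭-trans; ↭⇒↭ₛ)
open import Data.List.Relation.Binary.Permutation.Propositional.Properties using (∈-resp-↭; ↭-length; ↭-reverse)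
import Data.List.Relation.Binary.Permutation.Setoid.Properties as ↭ₛ
open import Data.Product using (∃-syntax; _×_; _,_; proj₁; proj₂)
open import Data.Sum as Sum using (_⊎_; inj₁; inj₂)
open import Function using (_∘_; id)
open import Relation.Binary.PropositionalEquality
  using (_≡_; _≢_; refl; sym; trans; cong; cong₂; subst; setoid; module ≡-Reasoning)
open import Relation.Nullary using (¬_; does; yes; no)
open import Relation.Nullary.Decidable using (_⊎-dec_; dec-true; dec-false)
open import Relation.Unary using (Pred; Decidable)

open ≡-Reasoning

unique-↭ : ∀ {A : Set} {xs ys : List A} → xs ↭ ys → Unique xs → Unique ys
unique-↭ {A} σ = ↭ₛ.Unique-resp-↭ (setoid A) (↭⇒↭ₛ σ)

length≡2 : ∀ {A : Set} {xs : List A} → length xs ≡ 2 → ∃[ e ] ∃[ e' ] (xs ≡ e ∷ e' ∷ [])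
length≡2 {xs = e ∷ e' ∷ []} refl = e , e' , refl

split-at-length : ∀ {A : Set} m {n} (xs : List A) → length xs ≡ m + suc n →
                  ∃[ ys ] ∃[ z ] ∃[ zs ] (xs ≡ ys ++ z ∷ zs × length ys ≡ m × length zs ≡ n)
split-at-length zero    (z ∷ zs) eq = [] , z , zs , refl , refl , suc-injective eq
split-at-length (suc m) (x ∷ xs) eq with split-at-length m xs (suc-injective eq)
... | ys , z , zs , refl , refl , |zs| = x ∷ ys , z , zs , refl , refl , |zs|

∈-merge-head : ∀ {A : Set} {x y z : A} {xs} → x ≡ y → z ∈ x ∷ y ∷ xs → z ∈ y ∷ xs
∈-merge-head x≡y (here z≡x) = here (trans z≡x x≡y)
∈-merge-head _   (there z∈) = z∈

adjacent-distinct : ∀ {a b : ℕ} x u → a ∈ x ∷ u → b ∈ x ∷ u → a ≢ b →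
                    ∃[ v ] ∃[ y ] ∃[ z ] ∃[ v' ] (x ∷ u ≡ v ++ y ∷ z ∷ v' × y ≢ z)
adjacent-distinct x [] (here refl) (here refl) a≢b = ⊥-elim (a≢b refl)
adjacent-distinct x (y ∷ u) a∈ b∈ a≢b with x ≟ y
... | no x≢y = [] , x , y , u , refl , x≢y
... | yes x≡y with adjacent-distinct y u (∈-merge-head x≡y a∈) (∈-merge-head x≡y b∈) a≢b
...   | v , y' , z , v' , eq , y'≢z = x ∷ v , y' , z , v' , cong (x ∷_) eq , y'≢z

module _ {A : Set} {p} {P : Pred A p} (P? : Decidable P) where

  filter-reverse : ∀ xs → filter P? (reverse xs) ≡ reverse (filter P? xs)
  filter-reverse []       = refl
  filter-reverse (x ∷ xs) = begin
    filter P? (reverse (x ∷ xs))               ≡⟨ cong (filter P?) (unfold-reverse x xs) ⟩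
    filter P? (reverse xs ++ [ x ])            ≡⟨ filter-++ P? (reverse xs) [ x ] ⟩
    filter P? (reverse xs) ++ filter P? [ x ]  ≡⟨ cong (_++ filter P? [ x ]) (filter-reverse xs) ⟩
    reverse (filter P? xs) ++ filter P? [ x ]  ≡⟨ snoc-filter ⟩
    reverse (filter P? (x ∷ xs))               ∎
    where
    snoc-filter : reverse (filter P? xs) ++ filter P? [ x ] ≡ reverse (filter P? (x ∷ xs))
    snoc-filter with does (P? x)
    ... | true  = sym (unfold-reverse x (filter P? xs))
    ... | false = ++-identityʳ _

∈-concat-↭ : ∀ {A : Set} {L : List A} {z xss} → All (_↭ L) xss → z ∈ concat xss → z ∈ L
∈-concat-↭ {xss = xss} perms z∈ with ∈-concat⁻′ xss z∈
... | xs , z∈xs , xs∈xss = ∈-resp-↭ (All.lookup perms xs∈xss) z∈xs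

OneOf : {A : Set} → A → A → A → Set
OneOf p q z = z ≡ p ⊎ z ≡ q

oneOf? : (p q : ℕ) → Decidable (OneOf p q)
oneOf? p q z = (z ≟ p) ⊎-dec (z ≟ q)

oneOf-distinct : ∀ {A : Set} {a b x y z : A} → OneOf a b x → OneOf a b y → x ≢ y →
                 OneOf a b z → OneOf x y z
oneOf-distinct (inj₁ refl) (inj₁ refl) x≢y _ = ⊥-elim (x≢y refl)
oneOf-distinct (inj₂ refl) (inj₂ refl) x≢y _ = ⊥-elim (x≢y refl)
oneOf-distinct (inj₁ refl) (inj₂ refl) _   = id
oneOf-distinct (inj₂ refl) (inj₁ refl) _   = Sum.swap

PairPerm : {A : Set} → A → A → List A → Set
PairPerm p q xs = xs ≡ p ∷ q ∷ [] ⊎ xs ≡ q ∷ p ∷ []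

unique-pair : ∀ {A : Set} {p q : A} {xs} → p ≢ q → Unique xs → All (OneOf p q) xs →
              p ∈ xs → q ∈ xs → PairPerm p q xs
unique-pair {xs = _ ∷ []}     p≢q _ _ (here refl) (here refl) = ⊥-elim (p≢q refl)
unique-pair {xs = _ ∷ _ ∷ []} p≢q _ _ (here refl) (here refl) = ⊥-elim (p≢q refl)
unique-pair {xs = _ ∷ _ ∷ []} _   _ _ (here refl) (there (here refl)) = inj₁ refl
unique-pair {xs = _ ∷ _ ∷ []} _   _ _ (there (here refl)) (here refl) = inj₂ refl
unique-pair {xs = _ ∷ _ ∷ []} p≢q _ _ (there (here refl)) (there (here refl)) = ⊥-elim (p≢q refl)
unique-pair {xs = _ ∷ _ ∷ _ ∷ _} _ ((x≢y ∷ x≢z ∷ _) ∷ (y≢z ∷ _) ∷ _) (ox ∷ oy ∷ oz ∷ _) _ _ =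
  ⊥-elim (pigeonhole ox oy oz x≢y x≢z y≢z)
  where
  pigeonhole : ∀ {A : Set} {p q x y z : A} → OneOf p q x → OneOf p q y → OneOf p q z →
               x ≢ y → x ≢ z → y ≢ z → ⊥
  pigeonhole (inj₁ refl) (inj₁ refl) _           x≢y _   _   = x≢y refl
  pigeonhole (inj₂ refl) (inj₂ refl) _           x≢y _   _   = x≢y refl
  pigeonhole (inj₁ refl) (inj₂ refl) (inj₁ refl) _   x≢z _   = x≢z refl
  pigeonhole (inj₁ refl) (inj₂ refl) (inj₂ refl) _   _   y≢z = y≢z refl
  pigeonhole (inj₂ refl) (inj₁ refl) (inj₁ refl) _   _   y≢z = y≢z refl
  pigeonhole (inj₂ refl) (inj₁ refl) (inj₂ refl) _   x≢z _   = x≢z refl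

filter-unique-pair : ∀ {p q L} → p ≢ q → Unique L → p ∈ L → q ∈ L →
                     PairPerm p q (filter (oneOf? p q) L)
filter-unique-pair {p} {q} {L} p≢q uL p∈L q∈L =
  unique-pair p≢q (Uniqueₚ.filter⁺ (oneOf? p q) uL)
    (All.tabulate (proj₂ ∘ ∈-filter⁻ (oneOf? p q) {xs = L}))
    (∈-filter⁺ (oneOf? p q) p∈L (inj₁ refl)) (∈-filter⁺ (oneOf? p q) q∈L (inj₂ refl))

⊆-map⁻ : ∀ {A B : Set} {f : A → B} {u} X → u ⊆ map f X → ∃[ w ] (w ⊆ X × map f w ≡ u)
⊆-map⁻ []      []         = [] , [] , refl
⊆-map⁻ (x ∷ X) (_ ∷ʳ σ)   with ⊆-map⁻ X σ
... | w , w⊆X , refl = w , x ∷ʳ w⊆X , refl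
⊆-map⁻ (x ∷ X) (refl ∷ σ) with ⊆-map⁻ X σ
... | w , w⊆X , refl = x ∷ w , refl ∷ w⊆X , refl

contains-by-renaming : ∀ {f X u} → InjectiveOn f X → u ⊆ map f X → Contains X u
contains-by-renaming {f} {X} f-inj σ with ⊆-map⁻ X σ
... | w , w⊆X , fw≡u =
  w , w⊆X , f , (λ z∈w z'∈w → f-inj (lookup w⊆X z∈w) (lookup w⊆X z'∈w)) , fw≡u

restrict-to-pair : ∀ {a b u X} → All (OneOf a b) u → a ∈ u → b ∈ u → Contains X u →
  ∃[ p ] ∃[ q ] ∃[ f ] (f p ≡ a × f q ≡ b × p ∈ X × q ∈ X × u ⊆ map f (filter (oneOf? p q) X))
restrict-to-pair {a} {b} {X = X} ab a∈ b∈ (w , w⊆X , f , f-inj , fw≡u)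
  with ∈-map⁻ f (subst (a ∈_) (sym fw≡u) a∈) | ∈-map⁻ f (subst (b ∈_) (sym fw≡u) b∈)
... | p , p∈w , a≡fp | q , q∈w , b≡fq =
  p , q , f , sym a≡fp , sym b≡fq , lookup w⊆X p∈w , lookup w⊆X q∈w ,
  subst (_⊆ _) fw≡u (map⁺ f w⊆pairs)
  where
  w-over-pq : All (OneOf p q) w
  w-over-pq = All.tabulate λ z∈w →
    Sum.map (λ fz≡a → f-inj z∈w p∈w (trans fz≡a a≡fp)) (λ fz≡b → f-inj z∈w q∈w (trans fz≡b b≡fq))
            (All.lookup ab (subst (f _ ∈_) fw≡u (∈-map⁺ f z∈w)))
  w⊆pairs : w ⊆ filter (oneOf? p q) X
  w⊆pairs = subst (_⊆ _) (filter-all (oneOf? p q) w-over-pq)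
                  (filter⁺ (oneOf? p q) (oneOf? p q) (λ { refl → id }) w⊆X)

-- Upper bound

letters-⊆-blocks : ∀ {A : Set} {x y : A} {v cs} → All (OneOf x y) v →
                   All (λ c → x ∈ c × y ∈ c) cs → length v ≡ length cs → v ⊆ concat cs
letters-⊆-blocks []        []                 _  = []
letters-⊆-blocks (oz ∷ ov) ((x∈c , y∈c) ∷ cs) eq =
  ++⁺ (from∈ (Sum.[ (λ { refl → x∈c }) , (λ { refl → y∈c }) ] oz))
      (letters-⊆-blocks ov cs (suc-injective eq))

module PairRenaming {e e' x y : ℕ} (e≢e' : e ≢ e') (x≢y : x ≢ y) where

  rename : ℕ → ℕ
  rename z = if does (z ≟ e) then x else y

  rename-e : rename e ≡ x
  rename-e rewrite dec-true (e ≟ e) refl = refl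

  rename-e' : rename e' ≡ y
  rename-e' rewrite dec-false (e' ≟ e) (e≢e' ∘ sym) = refl

  rename-injectiveOn : InjectiveOn rename (e ∷ e' ∷ [])
  rename-injectiveOn (here refl)         (here refl)         _  = refl
  rename-injectiveOn (there (here refl)) (there (here refl)) _  = refl
  rename-injectiveOn (here refl)         (there (here refl)) eq =
    ⊥-elim (x≢y (trans (sym rename-e) (trans eq rename-e')))
  rename-injectiveOn (there (here refl)) (here refl)         eq =
    ⊥-elim (x≢y (trans (sym rename-e) (trans (sym eq) rename-e')))

  renamed-block : ∀ {blk} → blk ↭ e ∷ e' ∷ [] → x ∈ map rename blk × y ∈ map rename blk
  renamed-block {blk} σ =
    subst (_∈ map rename blk) rename-e  (∈-map⁺ rename (∈-resp-↭ (↭-sym σ) (here refl))) ,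
    subst (_∈ map rename blk) rename-e' (∈-map⁺ rename (∈-resp-↭ (↭-sym σ) (there (here refl))))

adjacent-pair-contained : ∀ {x y e e' : ℕ} v v' bs₁ bs₂ → x ≢ y → Unique (e ∷ e' ∷ []) →
  All (OneOf x y) (v ++ x ∷ y ∷ v') → All (_↭ e ∷ e' ∷ []) (bs₁ ++ (e ∷ e' ∷ []) ∷ bs₂) →
  length v ≡ length bs₁ → length v' ≡ length bs₂ →
  Contains (concat (bs₁ ++ (e ∷ e' ∷ []) ∷ bs₂)) (v ++ x ∷ y ∷ v')
adjacent-pair-contained {e = e} {e'} v v' bs₁ bs₂ x≢y ((e≢e' ∷ []) ∷ _) letters perms |v| |v'|
  with Allₚ.++⁻ v letters | Allₚ.++⁻ bs₁ perms
... | letters₁ , _ ∷ _ ∷ letters₂ | perms₁ , _ ∷ perms₂ =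
  contains-by-renaming (λ z∈ z'∈ → rename-injectiveOn (∈-concat-↭ perms z∈) (∈-concat-↭ perms z'∈))
    (subst (_ ⊆_) (sym image)
      (++⁺ (letters-⊆-blocks letters₁ (renamed perms₁) (trans |v| (sym (length-map _ bs₁))))
           (sym rename-e ∷ sym rename-e' ∷
              letters-⊆-blocks letters₂ (renamed perms₂) (trans |v'| (sym (length-map _ bs₂))))))
  where
  open PairRenaming e≢e' x≢y

  renamed : ∀ {bs} → All (_↭ e ∷ e' ∷ []) bs → All (λ c → _ ∈ c × _ ∈ c) (map (map rename) bs)
  renamed = Allₚ.map⁺ ∘ All.map renamed-block

  image : map rename (concat (bs₁ ++ (e ∷ e' ∷ []) ∷ bs₂)) ≡
          concat (map (map rename) bs₁) ++ rename e ∷ rename e' ∷ concat (map (map rename) bs₂)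
  image = begin
    map rename (concat (bs₁ ++ (e ∷ e' ∷ []) ∷ bs₂))         ≡⟨ concat-map (bs₁ ++ _) ⟨
    concat (map (map rename) (bs₁ ++ (e ∷ e' ∷ []) ∷ bs₂))   ≡⟨ cong concat (map-++ (map rename) bs₁ _) ⟩
    concat (map (map rename) bs₁ ++ map (map rename) ((e ∷ e' ∷ []) ∷ bs₂))
                                                             ≡⟨ concat-++ (map (map rename) bs₁) _ ⟨
    concat (map (map rename) bs₁) ++ rename e ∷ rename e' ∷ concat (map (map rename) bs₂) ∎

pair-forced : ∀ {x y : ℕ} v v' → x ≢ y → All (OneOf x y) (v ++ x ∷ y ∷ v') →
              FormationForces (v ++ x ∷ y ∷ v') (length v + suc (length v'))
pair-forced v v' x≢y letters = 2 , forced
  where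
  forced : ∀ X → IsFormation 2 (length v + suc (length v')) X → Contains X (v ++ _ ∷ _ ∷ v')
  forced _ (L , |L| , uL , ps , |ps| , perms , refl) with split-at-length (length v) ps |ps|
  ... | bs₁ , blk , bs₂ , refl , |bs₁| , |bs₂| with All.head (proj₂ (Allₚ.++⁻ bs₁ perms))
  ... | blk↭L with length≡2 {xs = blk} (trans (↭-length blk↭L) |L|)
  ... | e , e' , refl =
    adjacent-pair-contained v v' bs₁ bs₂ x≢y (unique-↭ (↭-sym blk↭L) uL) letters
      (All.map (λ σ → ↭-trans σ (↭-sym blk↭L)) perms) (sym |bs₁|) (sym |bs₂|)

two-letters-forced : ∀ {a b : ℕ} u → a ≢ b → All (OneOf a b) u → a ∈ u → b ∈ u →
                     FormationForces u (length u ∸ 1)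
two-letters-forced (h ∷ T) a≢b ab a∈ b∈ with adjacent-distinct h T a∈ b∈ a≢b
... | v , x , y , v' , u≡ , x≢y with Allₚ.++⁻ v (subst (All _) u≡ ab)
... | _ , ox ∷ oy ∷ _ =
  subst (λ w → FormationForces w (length w ∸ 1)) (sym u≡)
    (subst (FormationForces _) (sym width)
      (pair-forced v v' x≢y (All.map (oneOf-distinct ox oy x≢y) (subst (All _) u≡ ab))))
  where
  width : length (v ++ x ∷ y ∷ v') ∸ 1 ≡ length v + suc (length v')
  width = cong (_∸ 1) (trans (length-++ v) (+-suc (length v) _))

-- Lower bound

TrailingBlock LeadingBlock : {A : Set} → A → List A → Set
TrailingBlock m blk = ∃[ y ] (y ≢ m × blk ≡ y ∷ m ∷ [])
LeadingBlock  m blk = ∃[ y ] (y ≢ m × blk ≡ m ∷ y ∷ [])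

trailing-blocks-⊈ : ∀ {A : Set} {B : A → List A} ms {r R} →
                    All (λ m → TrailingBlock m (B m)) ms → ¬ (ms ++ r ∷ R ⊆ concatMap B ms)
trailing-blocks-⊈ []       []                      ()
trailing-blocks-⊈ {B = B} (m ∷ ms) ((y , y≢m , B≡) ∷ trailing) σ
  with subst (λ blk → m ∷ ms ++ _ ⊆ blk ++ concatMap B ms) B≡ σ
... | .y ∷ʳ (.m ∷ʳ σ′) = trailing-blocks-⊈ ms trailing (∷ˡ⁻ σ′)
... | .y ∷ʳ (refl ∷ σ′) = trailing-blocks-⊈ ms trailing σ′
... | m≡y ∷ _           = y≢m (sym m≡y)

leading-blocks-⊈ : ∀ {A : Set} {B : A → List A} ms {x R} →
                   All (λ m → LeadingBlock m (B m)) ms → ¬ (x ∷ ms ++ R ⊆ concatMap B ms)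
leading-blocks-⊈ []       []                      ()
leading-blocks-⊈ {B = B} (m ∷ ms) ((y , y≢m , B≡) ∷ leading) σ
  with subst (λ blk → _ ∷ m ∷ ms ++ _ ⊆ blk ++ concatMap B ms) B≡ σ
... | .m ∷ʳ (.y ∷ʳ σ′)  = leading-blocks-⊈ ms leading (∷ˡ⁻ σ′)
... | .m ∷ʳ (_ ∷ σ′)    = leading-blocks-⊈ ms leading σ′
... | _ ∷ (.y ∷ʳ σ′)    = leading-blocks-⊈ ms leading σ′
... | _ ∷ (m≡y ∷ _)     = y≢m (sym m≡y)

orient : ∀ {A : Set} → Bool → List A → List A
orient true  xs = xs
orient false xs = reverse xs

oriented : ℕ → List ℕ → ℕ → List ℕ
oriented b L m = orient (does (m ≟ b)) L

oriented-↭ : ∀ b L ms → All (_↭ L) (map (oriented b L) ms)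
oriented-↭ b L ms = Allₚ.map⁺ (All.universal (λ m → orient-↭ (does (m ≟ b))) ms)
  where
  orient-↭ : ∀ β → orient β L ↭ L
  orient-↭ true  = ↭-refl
  orient-↭ false = ↭-reverse L

map-filter-oriented : ∀ {p} {P : Pred ℕ p} (f : ℕ → ℕ) (P? : Decidable P) b {L c} →
  map f (filter P? L) ≡ c →
  ∀ ms → map f (filter P? (concatMap (oriented b L) ms)) ≡ concatMap (oriented b c) ms
map-filter-oriented f P? b         eq []       = refl
map-filter-oriented f P? b {L} {c} eq (m ∷ ms) = begin
  map f (filter P? (oriented b L m ++ concatMap (oriented b L) ms))
    ≡⟨ cong (map f) (filter-++ P? (oriented b L m) _) ⟩
  map f (filter P? (oriented b L m) ++ filter P? (concatMap (oriented b L) ms))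
    ≡⟨ map-++ f (filter P? (oriented b L m)) _ ⟩
  map f (filter P? (oriented b L m)) ++ map f (filter P? (concatMap (oriented b L) ms))
    ≡⟨ cong₂ _++_ (trans (map-filter-orient (does (m ≟ b))) (cong (orient (does (m ≟ b))) eq))
                  (map-filter-oriented f P? b eq ms) ⟩
  oriented b c m ++ concatMap (oriented b c) ms ∎
  where
  map-filter-orient : ∀ β → map f (filter P? (orient β L)) ≡ orient β (map f (filter P? L))
  map-filter-orient true  = refl
  map-filter-orient false =
    trans (cong (map f) (filter-reverse P? L)) (reverse-map f (filter P? L))

trailing-oriented : ∀ {a b m} → a ≢ b → OneOf a b m → TrailingBlock m (oriented b (a ∷ b ∷ []) m)
trailing-oriented {a} {b} a≢b (inj₁ refl) rewrite dec-false (a ≟ b) a≢b = b , a≢b ∘ sym , refl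
trailing-oriented {a} {b} a≢b (inj₂ refl) rewrite dec-true (b ≟ b) refl = a , a≢b , refl

leading-oriented : ∀ {a b m} → a ≢ b → OneOf a b m → LeadingBlock m (oriented b (b ∷ a ∷ []) m)
leading-oriented {a} {b} a≢b (inj₁ refl) rewrite dec-false (a ≟ b) a≢b = b , a≢b ∘ sym , refl
leading-oriented {a} {b} a≢b (inj₂ refl) rewrite dec-true (b ≟ b) refl = a , a≢b , refl

oriented-restriction : ∀ {a b L u} ms → a ≢ b → Unique L → All (OneOf a b) u → a ∈ u → b ∈ u →
  Contains (concatMap (oriented b L) ms) u →
  u ⊆ concatMap (oriented b (a ∷ b ∷ [])) ms ⊎ u ⊆ concatMap (oriented b (b ∷ a ∷ [])) ms
oriented-restriction {b = b} {L} ms a≢b uL ab a∈ b∈ contains with restrict-to-pair ab a∈ b∈ contains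
... | p , q , f , fp≡a , fq≡b , p∈X , q∈X , u⊆
  with filter-unique-pair (λ p≡q → a≢b (trans (sym fp≡a) (trans (cong f p≡q) fq≡b))) uL
         (∈-concat-↭ (oriented-↭ b L ms) p∈X) (∈-concat-↭ (oriented-↭ b L ms) q∈X)
... | inj₁ pq = inj₁ (subst (_ ⊆_) (map-filter-oriented f (oneOf? p q) b
                        (trans (cong (map f) pq) (cong₂ (λ s t → s ∷ t ∷ []) fp≡a fq≡b)) ms) u⊆)
... | inj₂ qp = inj₂ (subst (_ ⊆_) (map-filter-oriented f (oneOf? p q) b
                        (trans (cong (map f) qp) (cong₂ (λ s t → s ∷ t ∷ []) fq≡b fp≡a)) ms) u⊆)

formation-avoids : ∀ {a b L h} ys {r R} → a ≢ b → Unique L → All (OneOf a b) (h ∷ ys ++ r ∷ R) →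
  a ∈ h ∷ ys ++ r ∷ R → b ∈ h ∷ ys ++ r ∷ R →
  ¬ Contains (concatMap (oriented b L) ys) (h ∷ ys ++ r ∷ R)
formation-avoids ys a≢b uL ab a∈ b∈ contains with oriented-restriction ys a≢b uL ab a∈ b∈ contains
... | inj₁ u⊆ =
  trailing-blocks-⊈ ys (All.map (trailing-oriented a≢b) (proj₁ (Allₚ.++⁻ ys (All.tail ab)))) (∷ˡ⁻ u⊆)
... | inj₂ u⊆ =
  leading-blocks-⊈ ys (All.map (leading-oriented a≢b) (proj₁ (Allₚ.++⁻ ys (All.tail ab)))) u⊆

two-letters-not-forced : ∀ {a b : ℕ} u {s} → a ≢ b → All (OneOf a b) u → a ∈ u → b ∈ u →
                         s < length u ∸ 1 → ¬ FormationForces u s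
two-letters-not-forced {b = b} (h ∷ T) {s} a≢b ab a∈ b∈ s<|T| (r , forces)
  with m≤n⇒∃[o]m+o≡n s<|T|
... | n , suc-s+n≡|T| with split-at-length s T (sym (trans (+-suc s n) suc-s+n≡|T|))
... | ys , _ , _ , refl , |ys| , _ =
  formation-avoids ys a≢b (upTo⁺ r) ab a∈ b∈
    (forces _ (upTo r , length-upTo r , upTo⁺ r , map (oriented b (upTo r)) ys ,
               trans (length-map _ ys) |ys| , oriented-↭ b (upTo r) ys , refl))

lemma2p7 : (u : Seq) (t : ℕ) → ExactlyTwoLetters u → length u ≡ t →
    FormationWidthIs u (t ∸ 1)
lemma2p7 u _ (a , b , a≢b , a∈ , b∈ , two-letters) refl =
  two-letters-forced u a≢b letters a∈ b∈ ,
  λ _ s<width → two-letters-not-forced u a≢b letters a∈ b∈ s<width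
  where
  letters : All (OneOf a b) u
  letters = All.tabulate two-letters
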